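{- Let $G$ be a two-rooted Eulerian graph on vertices $v_1,\dots,v_n$ with roots $v_1$ and $v_n$, and let $A$ be its adjacency matrix over $\mathbb F_2$. Then $G$ is \textbf{gcds}-sortable if and only if $\ker(A)$ contains a vector $\vec x$ with $x_1+x_n=1$.
   Context: A graph is Eulerian if every vertex has even degree. With $f_a(b)=1$ iff $a,b$ adjacent, for adjacent non-root vertices $p,q$, $\textbf{gcds}_{\{p,q\}}(G)$ is the graph on the same vertices where distinct $s,t$ are adjacent iff $f_p(s)f_q(t)+f_q(s)f_p(t)+f_s(t)\equiv1\pmod 2$. $G$ is \textbf{gcds}-sortable if finitely many such operations yield the edgeless graph. -}

module Defs where

open import Data.Nat using (ℕ; suc)
open import Data.Nat.Divisibility using (_∣_)
open import Data.Bool using (Bool; true; false; _∧_; _xor_; if_then_else_)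
open import Data.Fin using (Fin; zero; suc; fromℕ; _≟_)
open import Data.List using (List; map; foldr; allFin)
open import Data.Nat.ListAction using (sum)
open import Relation.Nullary using (¬_; yes; no)
open import Relation.Binary.PropositionalEquality using (_≡_)

Graph : ℕ → Set
Graph n = Fin n → Fin n → Bool

record IsSimple {n : ℕ} (G : Graph n) : Set where
  field
    symmetric   : ∀ s t → G s t ≡ G t s
    irreflexive : ∀ s → G s s ≡ false

degree : {n : ℕ} → Graph n → Fin n → ℕ
degree {n} G i = sum (map (λ j → if G i j then 1 else 0) (allFin n))

Eulerian : {n : ℕ} → Graph n → Set
Eulerian G = ∀ i → 2 ∣ degree G i

-- Vertices v₁ … vₙ are Fin (suc (suc m)) (n = m + 2 ≥ 2); roots v₁ = zero, vₙ = fromℕ (suc m).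
root₁ : {m : ℕ} → Fin (suc (suc m))
root₁ = zero

rootₙ : {m : ℕ} → Fin (suc (suc m))
rootₙ {m} = fromℕ (suc m)

NonRoot : {m : ℕ} → Fin (suc (suc m)) → Set
NonRoot v = ¬ (v ≡ root₁) × ¬ (v ≡ rootₙ)
  where open import Data.Product using (_×_)

gcds : {n : ℕ} → Fin n → Fin n → Graph n → Graph n
gcds p q G s t with s ≟ t
... | yes _ = false
... | no  _ = ((G p s ∧ G q t) xor (G q s ∧ G p t)) xor G s t

Edgeless : {n : ℕ} → Graph n → Set
Edgeless G = ∀ s t → G s t ≡ false

data Sortable {m : ℕ} : Graph (suc (suc m)) → Set where
  done : ∀ {G} → Edgeless G → Sortable G
  step : ∀ {G} (p q : Fin (suc (suc m))) → NonRoot p → NonRoot q → G p q ≡ true →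
         Sortable (gcds p q G) → Sortable G

xsum : {n : ℕ} → (Fin n → Bool) → Bool
xsum {n} f = foldr _xor_ false (map f (allFin n))

InKernel : {n : ℕ} → Graph n → (Fin n → Bool) → Set
InKernel G x = ∀ i → xsum (λ j → G i j ∧ x j) ≡ false

-- Over 𝔽₂, a gcds step on adjacent p, q turns the adjacency matrix A into
-- A' = A + a_p a_qᵀ + a_q a_pᵀ (a_v the columns of A).  Hence A'x = Ax + (a_q·x) a_p + (a_p·x) a_q:
-- every kernel vector of A lies in ker A', and conversely A'x = A x' for
-- x' = x + (a_q·x) e_p + (a_p·x) e_q, which agrees with x at the roots.  Pulling e₁ back along a
-- sorting sequence gives the kernel vector.  For the converse, G is Eulerian iff the all-ones
-- vector lies in ker A, so both it and x survive every step; each step isolates p and leaves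
-- isolated vertices isolated, so the process stops, and once no two non-roots are adjacent,
-- orthogonality of every row to 1 and to x (with x₁ + xₙ = 1) forces the graph to be edgeless.
module Submission where

open import Defs
open import Data.Nat using (ℕ; suc; _+_; parity)
open import Data.Nat.Divisibility using (_∣_; divides-refl)
open import Data.Nat.ListAction using (sum)
open import Data.Parity using (0ℙ) renaming (_+_ to _+ℙ_)
open import Data.Parity.Properties using (+-homo-+; *-homo-*; *-zeroʳ)
open import Data.Bool as Bool using (Bool; true; false; _∧_; _xor_; if_then_else_)
open import Data.Bool.Properties
  using (xor-∧-commutativeRing; xor-same; xor-comm; xor-identityʳ; ∧-comm; ∧-assoc;
         ∧-zeroʳ; ∧-identityʳ; ∧-distribʳ-xor; ¬-not)
open import Data.Fin using (Fin; zero; suc; _≟_)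
open import Data.Fin.Properties using (any?)
open import Data.Fin.Subset using (Subset; _∈_; _⊂_; _⊆_)
open import Data.Fin.Subset.Induction using (⊂-wellFounded)
open import Data.List using (List; []; _∷_; map; foldr; tabulate; allFin)
import Data.Vec as Vec
open import Data.Vec.Properties using (lookup∘tabulate; []=⇒lookup; lookup⇒[]=)
open import Data.Vec.Functional using (Vector)
open import Data.Product using (Σ; ∃; ∃₂; _×_; _,_; proj₁; proj₂)
open import Data.Sum using (_⊎_; inj₁; inj₂)
open import Data.Empty using (⊥-elim)
open import Algebra.Bundles using (CommutativeRing)
open import Function.Base using (_∘_)
open import Function.Bundles using (_⇔_; mk⇔)
open import Induction.WellFounded using (Acc; acc)
open import Relation.Nullary using (¬_; Dec; yes; no; does)
open import Relation.Nullary.Decidable using (¬?; _×-dec_; dec-true; dec-false)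
open import Relation.Binary.PropositionalEquality
  using (_≡_; _≢_; _≗_; refl; sym; trans; cong; cong₂; module ≡-Reasoning)

open import Algebra.Properties.Semiring.Sum (CommutativeRing.semiring xor-∧-commutativeRing)
  using (sum-cong-≗; sum-replicate-zero; ∑-distrib-+; *-distribˡ-sum)
  renaming (sum to ∑)

private variable n : ℕ

infixl 6 _⊕_
infixr 7 _•_
infix 8 _·_

_⊕_ : Vector Bool n → Vector Bool n → Vector Bool n
(u ⊕ v) j = u j xor v j

_•_ : Bool → Vector Bool n → Vector Bool n
(a • u) j = a ∧ u j

_·_ : Vector Bool n → Vector Bool n → Bool
u · x = xsum (λ j → u j ∧ x j)

δ : Fin n → Vector Bool n
δ a j = does (a ≟ j)

xsum-tabulate : ∀ {m} (f : Fin n → Bool) (g : Fin m → Fin n) →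
                foldr _xor_ false (map f (tabulate g)) ≡ ∑ (f ∘ g)
xsum-tabulate {m = 0} f g = refl
xsum-tabulate {m = suc m} f g = cong (f (g zero) xor_) (xsum-tabulate f (g ∘ suc))

xsum≡∑ : (f : Vector Bool n) → xsum f ≡ ∑ f
xsum≡∑ f = xsum-tabulate f (λ j → j)

·≡∑ : (u x : Vector Bool n) → u · x ≡ ∑ (λ j → u j ∧ x j)
·≡∑ u x = xsum≡∑ (λ j → u j ∧ x j)

·-cong : {u v : Vector Bool n} → u ≗ v → ∀ x → u · x ≡ v · x
·-cong {u = u} {v} u≗v x = begin
  u · x                   ≡⟨ ·≡∑ u x ⟩
  ∑ (λ j → u j ∧ x j)     ≡⟨ sum-cong-≗ (λ j → cong (_∧ x j) (u≗v j)) ⟩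
  ∑ (λ j → v j ∧ x j)     ≡⟨ ·≡∑ v x ⟨
  v · x                   ∎
  where open ≡-Reasoning

·-comm : (u x : Vector Bool n) → u · x ≡ x · u
·-comm u x = begin
  u · x                   ≡⟨ ·≡∑ u x ⟩
  ∑ (λ j → u j ∧ x j)     ≡⟨ sum-cong-≗ (λ j → ∧-comm (u j) (x j)) ⟩
  ∑ (λ j → x j ∧ u j)     ≡⟨ ·≡∑ x u ⟨
  x · u                   ∎
  where open ≡-Reasoning

·-distribʳ-⊕ : (u v x : Vector Bool n) → (u ⊕ v) · x ≡ (u · x) xor (v · x)
·-distribʳ-⊕ u v x = begin
  (u ⊕ v) · x
    ≡⟨ ·≡∑ (u ⊕ v) x ⟩
  ∑ (λ j → (u j xor v j) ∧ x j)
    ≡⟨ sum-cong-≗ (λ j → ∧-distribʳ-xor (x j) (u j) (v j)) ⟩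
  ∑ (λ j → (u j ∧ x j) xor (v j ∧ x j))
    ≡⟨ ∑-distrib-+ (λ j → u j ∧ x j) (λ j → v j ∧ x j) ⟩
  ∑ (λ j → u j ∧ x j) xor ∑ (λ j → v j ∧ x j)
    ≡⟨ cong₂ _xor_ (·≡∑ u x) (·≡∑ v x) ⟨
  (u · x) xor (v · x)
    ∎
  where open ≡-Reasoning

•-·-assoc : (a : Bool) (u x : Vector Bool n) → (a • u) · x ≡ a ∧ (u · x)
•-·-assoc a u x = begin
  (a • u) · x                    ≡⟨ ·≡∑ (a • u) x ⟩
  ∑ (λ j → (a ∧ u j) ∧ x j)      ≡⟨ sum-cong-≗ (λ j → ∧-assoc a (u j) (x j)) ⟩
  ∑ (λ j → a ∧ (u j ∧ x j))      ≡⟨ sym (*-distribˡ-sum a (λ j → u j ∧ x j)) ⟩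
  a ∧ ∑ (λ j → u j ∧ x j)        ≡⟨ cong (a ∧_) (·≡∑ u x) ⟨
  a ∧ (u · x)                    ∎
  where open ≡-Reasoning

∑-δ : (a : Fin n) (x : Vector Bool n) → ∑ (λ j → δ a j ∧ x j) ≡ x a
∑-δ {suc n} zero x = trans (cong (x zero xor_) (sum-replicate-zero n)) (xor-identityʳ (x zero))
∑-δ {suc n} (suc a) x = ∑-δ a (x ∘ suc)

δ-· : (a : Fin n) (x : Vector Bool n) → δ a · x ≡ x a
δ-· a x = trans (·≡∑ (δ a) x) (∑-δ a x)

·-zeroˡ : (x : Vector Bool n) → (λ _ → false) · x ≡ false
·-zeroˡ {n} x = trans (·≡∑ (λ _ → false) x) (sum-replicate-zero n)

lincomb-· : (a b : Bool) (u v x : Vector Bool n) →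
            (a • u ⊕ b • v) · x ≡ (a ∧ (u · x)) xor (b ∧ (v · x))
lincomb-· a b u v x =
  trans (·-distribʳ-⊕ (a • u) (b • v) x) (cong₂ _xor_ (•-·-assoc a u x) (•-·-assoc b v x))

lincomb-⊕-· : (a b : Bool) (u v w x : Vector Bool n) →
              (a • u ⊕ b • v ⊕ w) · x ≡ ((a ∧ (u · x)) xor (b ∧ (v · x))) xor (w · x)
lincomb-⊕-· a b u v w x =
  trans (·-distribʳ-⊕ (a • u ⊕ b • v) w x) (cong (_xor (w · x)) (lincomb-· a b u v x))

δ-≢ : {a b : Fin n} → a ≢ b → δ a b ≡ false
δ-≢ {a = a} {b} = dec-false (a ≟ b)

·-two-point : {a b : Fin n} {u : Vector Bool n} → a ≢ b →
              (∀ t → t ≢ a → t ≢ b → u t ≡ false) →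
              ∀ y → u · y ≡ (u a ∧ y a) xor (u b ∧ y b)
·-two-point {a = a} {b} {u} a≢b outside y = begin
  u · y                                      ≡⟨ ·-cong decompose y ⟩
  (u a • δ a ⊕ u b • δ b) · y                ≡⟨ lincomb-· (u a) (u b) (δ a) (δ b) y ⟩
  (u a ∧ (δ a · y)) xor (u b ∧ (δ b · y))
    ≡⟨ cong₂ (λ c d → (u a ∧ c) xor (u b ∧ d)) (δ-· a y) (δ-· b y) ⟩
  (u a ∧ y a) xor (u b ∧ y b)                ∎
  where
  open ≡-Reasoning
  decompose : ∀ t → u t ≡ (u a ∧ does (a ≟ t)) xor (u b ∧ does (b ≟ t))
  decompose t with a ≟ t | b ≟ t
  ... | yes refl | yes refl = ⊥-elim (a≢b refl)
  ... | yes refl | no _ =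
    sym (trans (cong₂ _xor_ (∧-identityʳ (u a)) (∧-zeroʳ (u b))) (xor-identityʳ (u a)))
  ... | no _ | yes refl = sym (cong₂ _xor_ (∧-zeroʳ (u a)) (∧-identityʳ (u b)))
  ... | no a≢t | no b≢t =
    trans (outside t (a≢t ∘ sym) (b≢t ∘ sym)) (sym (cong₂ _xor_ (∧-zeroʳ (u a)) (∧-zeroʳ (u b))))

ones : Vector Bool n
ones _ = true

indicator : Bool → ℕ
indicator b = if b then 1 else 0

parity-indicator-xor : ∀ b c →
                       parity (indicator (b xor c)) ≡ parity (indicator b) +ℙ parity (indicator c)
parity-indicator-xor false c = refl
parity-indicator-xor true false = refl
parity-indicator-xor true true = refl

parity-count : ∀ {a} {A : Set a} (xs : List A) (f : A → Bool) →
               parity (sum (map (indicator ∘ f) xs)) ≡ parity (indicator (foldr _xor_ false (map f xs)))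
parity-count [] f = refl
parity-count (y ∷ xs) f = begin
  parity (indicator (f y) + sum (map (indicator ∘ f) xs))
    ≡⟨ +-homo-+ (indicator (f y)) _ ⟩
  parity (indicator (f y)) +ℙ parity (sum (map (indicator ∘ f) xs))
    ≡⟨ cong (parity (indicator (f y)) +ℙ_) (parity-count xs f) ⟩
  parity (indicator (f y)) +ℙ parity (indicator (foldr _xor_ false (map f xs)))
    ≡⟨ parity-indicator-xor (f y) _ ⟨
  parity (indicator (f y xor foldr _xor_ false (map f xs)))
    ∎
  where open ≡-Reasoning

parity-even : ∀ {d} → 2 ∣ d → parity d ≡ 0ℙ
parity-even (divides-refl k) = trans (*-homo-* k 2) (*-zeroʳ (parity k))

even-indicator : ∀ b → parity (indicator b) ≡ 0ℙ → b ≡ false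
even-indicator false _ = refl
even-indicator true ()

Eulerian⇒ones∈kernel : {G : Graph n} → Eulerian G → InKernel G ones
Eulerian⇒ones∈kernel {n} {G} eulerian i =
  trans (·-comm (G i) ones)
        (even-indicator (xsum (G i)) (trans (sym (parity-count (allFin n) (G i))) (parity-even (eulerian i))))

edgeless-kernel : {G : Graph n} → Edgeless G → ∀ x → InKernel G x
edgeless-kernel edgeless x i = trans (·-cong (edgeless i) x) (·-zeroˡ x)

gcds-lift : Graph n → Fin n → Fin n → Vector Bool n → Vector Bool n
gcds-lift G p q x = (G q · x) • δ p ⊕ (G p · x) • δ q ⊕ x

gcds-lift-≢ : ∀ {G : Graph n} {p q r : Fin n} {x} → p ≢ r → q ≢ r → gcds-lift G p q x r ≡ x r
gcds-lift-≢ {G = G} {p} {q} {r} {x} p≢r q≢r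
  rewrite δ-≢ p≢r | δ-≢ q≢r | ∧-zeroʳ (G q · x) | ∧-zeroʳ (G p · x) = refl

nonIsolated : Graph n → Fin n → Bool
nonIsolated G v = does (any? (λ t → G v t Bool.≟ true))

support : Graph n → Subset n
support G = Vec.tabulate (nonIsolated G)

∈-support⁺ : ∀ {G : Graph n} {v t} → G v t ≡ true → v ∈ support G
∈-support⁺ {G = G} {v} {t} e =
  lookup⇒[]= v (support G) (trans (lookup∘tabulate (nonIsolated G) v) (dec-true (any? _) (t , e)))

∈-support⁻ : ∀ {G : Graph n} {v} → v ∈ support G → ∃ λ t → G v t ≡ true
∈-support⁻ {G = G} {v} v∈
  with any? (λ t → G v t Bool.≟ true) | trans (sym (lookup∘tabulate (nonIsolated G) v)) ([]=⇒lookup v∈)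
... | yes edge | _ = edge
... | no _ | ()

nonzero-term : ∀ a b c d e → ((a ∧ b) xor (c ∧ d)) xor e ≡ true → a ≡ true ⊎ c ≡ true ⊎ e ≡ true
nonzero-term true _ _ _ _ _ = inj₁ refl
nonzero-term false _ true _ _ _ = inj₂ (inj₁ refl)
nonzero-term false _ false _ true _ = inj₂ (inj₂ refl)
nonzero-term false _ false _ false ()

annihilates-spanning-pair : ∀ {a b c d} → (a ∧ true) xor (b ∧ true) ≡ false →
                            (a ∧ c) xor (b ∧ d) ≡ false → c xor d ≡ true → a ≡ false × b ≡ false
annihilates-spanning-pair {false} {false} _ _ _ = refl , refl
annihilates-spanning-pair {true} {true} _ ac+bd≡0 c+d≡1 with trans (sym ac+bd≡0) c+d≡1
... | ()

module _ {G : Graph n} (simple : IsSimple G) where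
  open IsSimple simple

  -- On the diagonal the rank-two term vanishes in characteristic 2, matching the forced 'false'.
  gcds-row : ∀ p q s → gcds p q G s ≗ G p s • G q ⊕ G q s • G p ⊕ G s
  gcds-row p q s t with s ≟ t
  ... | yes refl rewrite irreflexive s | ∧-comm (G q s) (G p s) =
    sym (trans (xor-identityʳ _) (xor-same (G p s ∧ G q s)))
  ... | no _ = refl

  gcds-simple : ∀ p q → IsSimple (gcds p q G)
  gcds-simple p q = record { symmetric = symmetric′ ; irreflexive = irreflexive′ }
    where
    symmetric′ : ∀ s t → gcds p q G s t ≡ gcds p q G t s
    symmetric′ s t = begin
      gcds p q G s t                                       ≡⟨ gcds-row p q s t ⟩
      ((G p s ∧ G q t) xor (G q s ∧ G p t)) xor G s t      ≡⟨ cong₂ _xor_ swap (symmetric s t) ⟩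
      ((G p t ∧ G q s) xor (G q t ∧ G p s)) xor G t s      ≡⟨ gcds-row p q t s ⟨
      gcds p q G t s                                       ∎
      where
      open ≡-Reasoning
      swap : (G p s ∧ G q t) xor (G q s ∧ G p t) ≡ (G p t ∧ G q s) xor (G q t ∧ G p s)
      swap = trans (xor-comm (G p s ∧ G q t) (G q s ∧ G p t))
                   (cong₂ _xor_ (∧-comm (G q s) (G p t)) (∧-comm (G p s) (G q t)))
    irreflexive′ : ∀ s → gcds p q G s s ≡ false
    irreflexive′ s with s ≟ s
    ... | yes _ = refl
    ... | no s≢s = ⊥-elim (s≢s refl)

  gcds-· : ∀ p q s x →
           gcds p q G s · x ≡ ((G p s ∧ (G q · x)) xor (G q s ∧ (G p · x))) xor (G s · x)
  gcds-· p q s x =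
    trans (·-cong (gcds-row p q s) x) (lincomb-⊕-· (G p s) (G q s) (G q) (G p) (G s) x)

  gcds-kernel : ∀ p q {x} → InKernel G x → InKernel (gcds p q G) x
  gcds-kernel p q {x} ker s = begin
    gcds p q G s · x
      ≡⟨ gcds-· p q s x ⟩
    ((G p s ∧ (G q · x)) xor (G q s ∧ (G p · x))) xor (G s · x)
      ≡⟨ cong₂ (λ α β → ((G p s ∧ α) xor (G q s ∧ β)) xor (G s · x)) (ker q) (ker p) ⟩
    ((G p s ∧ false) xor (G q s ∧ false)) xor (G s · x)
      ≡⟨ cong₂ (λ α β → (α xor β) xor (G s · x)) (∧-zeroʳ (G p s)) (∧-zeroʳ (G q s)) ⟩
    G s · x
      ≡⟨ ker s ⟩
    false
      ∎
    where open ≡-Reasoning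

  gcds-lift-kernel : ∀ p q {x} → InKernel (gcds p q G) x → InKernel G (gcds-lift G p q x)
  gcds-lift-kernel p q {x} ker s = begin
    G s · y
      ≡⟨ ·-comm (G s) y ⟩
    y · G s
      ≡⟨ lincomb-⊕-· α β (δ p) (δ q) x (G s) ⟩
    ((α ∧ (δ p · G s)) xor (β ∧ (δ q · G s))) xor (x · G s)
      ≡⟨ cong₂ _xor_ (cong₂ _xor_ (coefficient α p) (coefficient β q)) (·-comm x (G s)) ⟩
    ((G p s ∧ α) xor (G q s ∧ β)) xor (G s · x)
      ≡⟨ gcds-· p q s x ⟨
    gcds p q G s · x
      ≡⟨ ker s ⟩
    false
      ∎
    where
    open ≡-Reasoning
    α = G q · x
    β = G p · x
    y = gcds-lift G p q x
    coefficient : ∀ c a → c ∧ (δ a · G s) ≡ G a s ∧ c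
    coefficient c a = trans (cong (c ∧_) (trans (δ-· a (G s)) (symmetric s a))) (∧-comm c (G a s))

  gcds-isolates : ∀ {p q} → G p q ≡ true → ∀ t → gcds p q G p t ≡ false
  gcds-isolates {p} {q} e t rewrite gcds-row p q p t | irreflexive p | symmetric q p | e = xor-same (G p t)

  gcds-support-⊂ : ∀ {p q} → G p q ≡ true → support (gcds p q G) ⊂ support G
  gcds-support-⊂ {p} {q} e = ⊆ , p , ∈-support⁺ e , p∉
    where
    ⊆ : support (gcds p q G) ⊆ support G
    ⊆ {v} v∈ with ∈-support⁻ v∈
    ... | t , e′
      with nonzero-term (G p v) (G q t) (G q v) (G p t) (G v t) (trans (sym (gcds-row p q v t)) e′)
    ... | inj₁ Gpv = ∈-support⁺ (trans (symmetric v p) Gpv)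
    ... | inj₂ (inj₁ Gqv) = ∈-support⁺ (trans (symmetric v q) Gqv)
    ... | inj₂ (inj₂ Gvt) = ∈-support⁺ Gvt
    p∉ : ¬ p ∈ support (gcds p q G)
    p∉ p∈ with ∈-support⁻ p∈
    ... | t , e′ with trans (sym (gcds-isolates e t)) e′
    ... | ()

module _ {m : ℕ} where
  OddOnRoots : Vector Bool (suc (suc m)) → Set
  OddOnRoots x = x root₁ xor x rootₙ ≡ true

  root₁≢rootₙ : root₁ {m} ≢ rootₙ
  root₁≢rootₙ ()

  root-or-nonRoot : (v : Fin (suc (suc m))) → v ≡ root₁ ⊎ v ≡ rootₙ ⊎ NonRoot v
  root-or-nonRoot v with v ≟ root₁ | v ≟ rootₙ
  ... | yes v≡r₁ | _ = inj₁ v≡r₁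
  ... | no _ | yes v≡rₙ = inj₂ (inj₁ v≡rₙ)
  ... | no v≢r₁ | no v≢rₙ = inj₂ (inj₂ (v≢r₁ , v≢rₙ))

  nonRoot? : (v : Fin (suc (suc m))) → Dec (NonRoot v)
  nonRoot? v = ¬? (v ≟ root₁) ×-dec ¬? (v ≟ rootₙ)

  InnerEdge : Graph (suc (suc m)) → Set
  InnerEdge G = ∃₂ λ p q → NonRoot p × NonRoot q × G p q ≡ true

  innerEdge? : (G : Graph (suc (suc m))) → Dec (InnerEdge G)
  innerEdge? G = any? λ p → any? λ q → nonRoot? p ×-dec nonRoot? q ×-dec G p q Bool.≟ true

  sortable⇒oddKernelVector : ∀ {G} → IsSimple G → Sortable G →
                             Σ (Vector Bool (suc (suc m))) λ x → InKernel G x × OddOnRoots x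
  sortable⇒oddKernelVector simple (done edgeless) = δ root₁ , edgeless-kernel edgeless (δ root₁) , refl
  sortable⇒oddKernelVector {G} simple (step p q (p≢r₁ , p≢rₙ) (q≢r₁ , q≢rₙ) _ sortable)
    with sortable⇒oddKernelVector (gcds-simple simple p q) sortable
  ... | x , ker , odd = gcds-lift G p q x , gcds-lift-kernel simple p q ker , odd′
    where
    odd′ : OddOnRoots (gcds-lift G p q x)
    odd′ = trans (cong₂ _xor_ (gcds-lift-≢ {G = G} {x = x} p≢r₁ q≢r₁)
                              (gcds-lift-≢ {G = G} {x = x} p≢rₙ q≢rₙ)) odd

  module _ {G : Graph (suc (suc m))} (simple : IsSimple G) (even : InKernel G ones)
           {x : Vector Bool (suc (suc m))} (ker : InKernel G x) (odd : OddOnRoots x)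
           (noInner : ∀ p q → NonRoot p → NonRoot q → G p q ≡ false) where
    open IsSimple simple

    root-supported : ∀ v → (∀ t → NonRoot t → G v t ≡ false) →
                     ∀ y → G v · y ≡ (G v root₁ ∧ y root₁) xor (G v rootₙ ∧ y rootₙ)
    root-supported v inner = ·-two-point root₁≢rootₙ (λ t t≢r₁ t≢rₙ → inner t (t≢r₁ , t≢rₙ))

    nonRoot-off-roots : ∀ {v} → NonRoot v → G v root₁ ≡ false × G v rootₙ ≡ false
    nonRoot-off-roots {v} nv = annihilates-spanning-pair
      (trans (sym (root-supported v (λ t → noInner v t nv) ones)) (even v))
      (trans (sym (root-supported v (λ t → noInner v t nv) x)) (ker v))
      odd

    nonRoot-isolated : ∀ {v} → NonRoot v → ∀ t → G v t ≡ false
    nonRoot-isolated nv t with root-or-nonRoot t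
    ... | inj₁ refl = proj₁ (nonRoot-off-roots nv)
    ... | inj₂ (inj₁ refl) = proj₂ (nonRoot-off-roots nv)
    ... | inj₂ (inj₂ nt) = noInner _ t nv nt

    roots-nonadjacent : G root₁ rootₙ ≡ false
    roots-nonadjacent = begin
      G root₁ rootₙ
        ≡⟨ ∧-identityʳ _ ⟨
      G root₁ rootₙ ∧ true
        ≡⟨ cong (λ a → (a ∧ true) xor (G root₁ rootₙ ∧ true)) (irreflexive root₁) ⟨
      (G root₁ root₁ ∧ true) xor (G root₁ rootₙ ∧ true)
        ≡⟨ root-supported root₁ (λ t nt → trans (symmetric root₁ t) (nonRoot-isolated nt root₁)) ones ⟨
      G root₁ · ones
        ≡⟨ even root₁ ⟩
      false
        ∎
      where open ≡-Reasoning

    noInnerEdge⇒Edgeless : Edgeless G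
    noInnerEdge⇒Edgeless s t with root-or-nonRoot s | root-or-nonRoot t
    ... | inj₂ (inj₂ ns) | _ = nonRoot-isolated ns t
    ... | _ | inj₂ (inj₂ nt) = trans (symmetric s t) (nonRoot-isolated nt s)
    ... | inj₁ refl | inj₁ refl = irreflexive root₁
    ... | inj₁ refl | inj₂ (inj₁ refl) = roots-nonadjacent
    ... | inj₂ (inj₁ refl) | inj₁ refl = trans (symmetric rootₙ root₁) roots-nonadjacent
    ... | inj₂ (inj₁ refl) | inj₂ (inj₁ refl) = irreflexive rootₙ

  oddKernelVector⇒sortable : ∀ {G x} → IsSimple G → InKernel G ones → InKernel G x → OddOnRoots x →
             Acc _⊂_ (support G) → Sortable G
  oddKernelVector⇒sortable {G} simple even ker odd (acc rec) with innerEdge? G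
  ... | yes (p , q , np , nq , e) =
    step p q np nq e (oddKernelVector⇒sortable (gcds-simple simple p q) (gcds-kernel simple p q even)
                               (gcds-kernel simple p q ker) odd (rec (gcds-support-⊂ simple e)))
  ... | no ∄inner = done (noInnerEdge⇒Edgeless simple even ker odd noInner)
    where
    noInner : ∀ p q → NonRoot p → NonRoot q → G p q ≡ false
    noInner p q np nq = ¬-not λ e → ∄inner (p , q , np , nq , e)

mainTheorem10 : (m : ℕ) (G : Graph (suc (suc m))) → IsSimple G → Eulerian G →
    Sortable G ⇔ Σ (Fin (suc (suc m)) → Bool) (λ x → InKernel G x × (x root₁ xor x rootₙ ≡ true))
mainTheorem10 m G simple eulerian = mk⇔ (sortable⇒oddKernelVector simple) λ (x , ker , odd) →
  oddKernelVector⇒sortable simple (Eulerian⇒ones∈kernel {G = G} eulerian) ker odd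
                           (⊂-wellFounded (support G))
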